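{- Let $k\geq 3$ and $t$ be positive integers and let $M^<_{k,t}$ be the ordered matching on $[m]$, $m=k(k-1)t^2$, constructed as follows. Partition $[m]$ into consecutive intervals $P_1,\dots,P_k$, each of size $(k-1)t^2$. Partition each $P_i$ into consecutive intervals (blocks) $B_{i,1},\dots,B_{i,(k-1)t}$, each of size $t$. For $i\in[k]$ and $j\in\{0,1,\dots,k-2\}$, let $a_j$ be the $(j+1)$st smallest element of $[k]\setminus\{i\}$ and let the superblock $C_{i,a_j}$ be the union of the blocks $B_{i,\ell}$ with $\ell\equiv j \pmod{k-1}$ (so each superblock is a union of $t$ blocks and has $t^2$ vertices). For every pair $i<j$ in $[k]$, place edges on $C_{i,j}\cup C_{j,i}$ (with its induced order) forming a copy of $M^<_t$, where $M^<_t$ is the ordered matching on $[2t^2]$ obtained by partitioning $[t^2]$ into consecutive intervals $I_1,\dots,I_t$ of size $t$ and $\{t^2+1,\dots,2t^2\}$ into consecutive intervals $J_1,\dots,J_t$ of size $t$, and joining, for all $i',j'\in[t]$, the $j'$th vertex of $I_{i'}$ to the $i'$th vertex of $J_{j'}$. Then for any two distinct $i,j\in[k]$: for any intervals $I\subseteq P_i$ and $J\subseteq P_j$, each of length at least $2kt$, there is an edge of $M^<_{k,t}$ between $I$ and $J$; moreover, there are at most $(2k+1)^2$ edges of $M^<_{k,t}$ between any two disjoint intervals $I'\subseteq P_i$ and $J'\subseteq P_j$, each of size at most $2kt$.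
   Context: An ordered matching is a $1$-regular graph with a linear order on its vertices; vertex sets of the form $[m]=\{1,\dots,m\}$ carry their natural order. An interval is a set of consecutive integers and its length (size) is its cardinality. A copy of $M^<_t$ on a set $S$ of $2t^2$ vertices means the image of $M^<_t$ under the unique order-preserving bijection $[2t^2]\to S$. -}

module Defs where

open import Data.Nat using (ℕ; zero; suc; _+_; _*_; _∸_; _≤_; _<_)
open import Data.Product using (Σ; ∃; ∃-syntax; _×_; _,_)
open import Data.Sum using (_⊎_)
open import Relation.Binary.PropositionalEquality using (_≡_)
open import Relation.Nullary using (¬_)

-- All vertices are natural numbers, 1-indexed as in the paper.

-- I_{i'} = {(i'-1)t+1, …, i't},  J_{j'} = {t²+(j'-1)t+1, …, t²+j't}.
-- The j'th vertex of I_{i'} is (i'-1)t + j'; the i'th vertex of J_{j'} is t² + (j'-1)t + i'.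
MtArc : ℕ → ℕ → ℕ → Set
MtArc t p q = ∃[ i' ] ∃[ j' ] (1 ≤ i' × i' ≤ t × 1 ≤ j' × j' ≤ t ×
                p ≡ (i' ∸ 1) * t + j' × q ≡ t * t + (j' ∸ 1) * t + i')

Mt : ℕ → ℕ → ℕ → Set
Mt t p q = MtArc t p q ⊎ MtArc t q p

InP : ℕ → ℕ → ℕ → ℕ → Set
InP k t i u = (i ∸ 1) * ((k ∸ 1) * (t * t)) + 1 ≤ u × u ≤ i * ((k ∸ 1) * (t * t))

InB : ℕ → ℕ → ℕ → ℕ → ℕ → Set
InB k t i ℓ u = 1 ≤ ℓ × ℓ ≤ (k ∸ 1) * t ×
  (i ∸ 1) * ((k ∸ 1) * (t * t)) + (ℓ ∸ 1) * t + 1 ≤ u ×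
  u ≤ (i ∸ 1) * ((k ∸ 1) * (t * t)) + ℓ * t

-- a_j = the (j+1)st smallest element of [k] \ {i}   (for j ∈ {0,…,k-2})
-- a j is that element iff it lies in [k], differs from i, and exactly j elements of
-- [k]\{i} are smaller than it; written out: a = j+1 if j+1 < i, else a = j+2.
aElem : ℕ → ℕ → ℕ → Set
aElem i j a = (j + 1 < i × a ≡ j + 1) ⊎ (i ≤ j + 1 × a ≡ j + 2)

-- Membership in the superblock C_{i,a}: the union of the blocks B_{i,ℓ} with
-- ℓ ≡ j (mod k-1), where a = a_j.  (Since 0 ≤ j < k-1, ℓ ≡ j mod (k-1) iff ℓ = j + r(k-1).)
InC : ℕ → ℕ → ℕ → ℕ → ℕ → Set
InC k t i a u = ∃[ j ] (j < k ∸ 1 × aElem i j a ×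
  ∃[ ℓ ] ((∃[ r ] ℓ ≡ j + r * (k ∸ 1)) × InB k t i ℓ u))

OrderIso : ℕ → (ℕ → Set) → (ℕ → ℕ) → Set
OrderIso n S f =
  (∀ p q → 1 ≤ p → p < q → q ≤ n → f p < f q) ×
  (∀ p → 1 ≤ p → p ≤ n → S (f p)) ×
  (∀ u → S u → ∃[ p ] (1 ≤ p × p ≤ n × f p ≡ u))

Edge : ℕ → ℕ → ℕ → ℕ → Set
Edge k t u v = ∃[ i ] ∃[ j ] (1 ≤ i × i < j × j ≤ k ×
  ∃[ f ] (OrderIso (2 * (t * t)) (λ w → InC k t i j w ⊎ InC k t j i w) f ×
    ∃[ p ] ∃[ q ] (Mt t p q × f p ≡ u × f q ≡ v)))

InInterval : ℕ → ℕ → ℕ → Set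
InInterval a len u = a ≤ u × u < a + len

IntervalSubP : ℕ → ℕ → ℕ → ℕ → ℕ → Set
IntervalSubP k t i a len = ∀ u → InInterval a len u → InP k t i u

Disjoint : ℕ → ℕ → ℕ → ℕ → Set
Disjoint a len b len' = ∀ u → InInterval a len u → ¬ InInterval b len' u

{-# OPTIONS --safe #-}
module Submission where

-- Inside a part P_i the blocks of a superblock C_{i,j} recur every k − 1 blocks, so an interval of
-- length at least kt in P_i contains a whole block of C_{i,j}.  In the copy of M^<_t on C_{i,j} ∪ C_{j,i},
-- vertex r₂ of block r₁ of C_{i,j} is joined to vertex r₁ of block r₂ of C_{j,i}; so whole blocks of
-- C_{i,j} in I and of C_{j,i} in J yield an edge between I and J.
-- For the upper bound, cut I′ and J′ into at most 2k chunks of t consecutive vertices.  Since k ≥ 3, two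
-- blocks of one superblock are never adjacent, so the chunk containing an endpoint of an edge determines
-- its block; the two block numbers r₁, r₂ determine the edge, so each of the (2k)² pairs of chunks carries
-- at most one edge.

open import Defs
open import Data.Nat using (ℕ; _+_; _*_; _^_; _≤_; _<_)
open import Relation.Binary.PropositionalEquality using (_≢_)
open import Data.Product using (Σ; ∃; ∃-syntax; _×_; _,_)
open import Data.List using (List; length)
open import Data.List.Relation.Unary.All using (All)
open import Data.List.Relation.Unary.Unique.Propositional using (Unique)

open import Data.Nat using (zero; suc; _∸_; z≤n; s≤s; NonZero; >-nonZero⁻¹)
open import Data.Nat.Properties
open import Data.Nat.DivMod
open import Data.Nat.Divisibility using (n∣m*n)
open import Data.Nat.Induction using (<-rec)
open import Data.Nat.Tactic.RingSolver using (solve-∀)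
open import Data.Fin using (Fin; zero; suc; fromℕ<; toℕ; combine)
open import Data.Fin.Properties using (injective⇒≤; toℕ-fromℕ<; combine-injective)
open import Data.List using (_∷_; lookup)
open import Data.List.Membership.Propositional.Properties using (∈-lookup)
import Data.List.Relation.Unary.All as All
open import Data.List.Relation.Unary.AllPairs using (_∷_)
open import Data.Product using (∃₂; proj₁)
open import Data.Sum using (_⊎_; inj₁; inj₂; swap)
open import Function using (_∘_)
open import Relation.Binary.PropositionalEquality using (_≡_; refl; sym; trans; cong; cong₂; subst; module ≡-Reasoning)
open import Relation.Binary.Definitions using (tri<; tri≈; tri>)
open import Relation.Nullary using (¬_; contradiction; yes; no)

[m*n+o]/n≡m : ∀ m {n o} .{{_ : NonZero n}} → o < n → (m * n + o) / n ≡ m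
[m*n+o]/n≡m m {n} {o} o<n = begin
  (m * n + o) / n    ≡⟨ +-distrib-/-∣ˡ o (n∣m*n m) ⟩
  m * n / n + o / n  ≡⟨ cong₂ _+_ (m*n/n≡m m n) (m<n⇒m/n≡0 o<n) ⟩
  m + 0              ≡⟨ +-identityʳ m ⟩
  m                  ∎
  where open ≡-Reasoning

[m*n+o]%n≡o : ∀ m {n o} .{{_ : NonZero n}} → o < n → (m * n + o) % n ≡ o
[m*n+o]%n≡o m {n} {o} o<n = begin
  (m * n + o) % n  ≡⟨ cong (_% n) (+-comm (m * n) o) ⟩
  (o + m * n) % n  ≡⟨ [m+kn]%n≡m%n o m n ⟩
  o % n            ≡⟨ m<n⇒m%n≡m o<n ⟩
  o                ∎
  where open ≡-Reasoning

m*n+o<p*n : ∀ {m n o p} → m < p → o < n → m * n + o < p * n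
m*n+o<p*n {m} {n} {o} m<p o<n = begin-strict
  m * n + o  <⟨ +-monoʳ-< (m * n) o<n ⟩
  m * n + n  ≡⟨ +-comm (m * n) n ⟩
  suc m * n  ≤⟨ *-monoˡ-≤ n m<p ⟩
  _          ∎
  where open ≤-Reasoning

m*m≤[m+1]^2 : ∀ m → m * m ≤ (m + 1) ^ 2
m*m≤[m+1]^2 m = ≤-trans (*-mono-≤ (m≤m+n m 1) (m≤m+n m 1))
  (≤-reflexive (cong ((m + 1) *_) (sym (*-identityʳ (m + 1)))))

bounded⇒offset : ∀ {x n u} → x + 1 ≤ u → u ≤ x + n → ∃[ s ] (s < n × u ≡ suc (x + s))
bounded⇒offset {x} {n} {u} x+1≤u u≤x+n = s , s<n , sym (m+[n∸m]≡n x<u)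
  where
  x<u : suc x ≤ u
  x<u = ≤-trans (≤-reflexive (+-comm 1 x)) x+1≤u
  s = u ∸ suc x
  s<n : s < n
  s<n = +-cancelˡ-≤ x (suc s) n (≤-trans (≤-reflexive (+-suc x s)) (subst (_≤ x + n) (sym (m+[n∸m]≡n x<u)) u≤x+n))

window-contains-residue : ∀ {n d} → d < n → ∀ q → ∃[ r ] (q < d + r * n × d + r * n ≤ q + n)
window-contains-residue {n} {zero} 0<n zero = 1 , ≤-trans 0<n (≤-reflexive (sym (+-identityʳ n))) , ≤-reflexive (+-identityʳ n)
window-contains-residue {n} {suc d} d<n zero = 0 , s≤s z≤n , ≤-trans (≤-reflexive (+-identityʳ (suc d))) (<⇒≤ d<n)
window-contains-residue {n} {d} d<n (suc q) with window-contains-residue d<n q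
... | r , q< , ≤q+n with d + r * n ≟ suc q
...   | no ne = r , ≤∧≢⇒< q< (λ e → ne (sym e)) , m≤n⇒m≤1+n ≤q+n
...   | yes e = suc r , subst (suc q <_) (sym next) (m<m+n (suc q) (≤-<-trans z≤n d<n)) , ≤-reflexive next
  where
  next : d + suc r * n ≡ suc q + n
  next = begin
    d + (n + r * n)  ≡⟨ cong (d +_) (+-comm n (r * n)) ⟩
    d + (r * n + n)  ≡⟨ sym (+-assoc d (r * n) n) ⟩
    d + r * n + n    ≡⟨ cong (_+ n) e ⟩
    suc q + n        ∎
    where open ≡-Reasoning

Unique⇒lookup-injective : ∀ {A : Set} {xs : List A} → Unique xs → ∀ {i j} → lookup xs i ≡ lookup xs j → i ≡ j
Unique⇒lookup-injective {xs = _ ∷ _} _            {zero}  {zero}  _ = refl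
Unique⇒lookup-injective {xs = _ ∷ _} (x∉xs ∷ _)   {zero}  {suc j} e = contradiction e (All.lookup x∉xs (∈-lookup j))
Unique⇒lookup-injective {xs = _ ∷ _} (x∉xs ∷ _)   {suc i} {zero}  e = contradiction (sym e) (All.lookup x∉xs (∈-lookup i))
Unique⇒lookup-injective {xs = _ ∷ _} (_ ∷ unique) {suc i} {suc j} e = cong suc (Unique⇒lookup-injective unique e)

module _ {A : Set} {P : A → Set} {n : ℕ} (key : ∀ {x} → P x → Fin n)
         (key-injective : ∀ {x y} (px : P x) (py : P y) → key px ≡ key py → x ≡ y) where

  Unique-length≤ : ∀ {xs} → Unique xs → All P xs → length xs ≤ n
  Unique-length≤ unique pxs =
    injective⇒≤ {f = λ i → key (All.lookup pxs (∈-lookup i))}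
      (λ e → Unique⇒lookup-injective unique (key-injective _ _ e))

module _ {t : ℕ} .{{_ : NonZero t}} {a l : ℕ} where

  chunk : ∀ M {u} → l ≤ M * t → InInterval a l u → Fin M
  chunk M {u} l≤Mt (a≤u , u<a+l) = fromℕ< (m<n*o⇒m/o<n (≤-trans u∸a<l l≤Mt))
    where
    u∸a<l : u ∸ a < l
    u∸a<l = subst (u ∸ a <_) (m+n∸m≡n a l) (∸-monoˡ-< u<a+l a≤u)

  chunk-close : ∀ M {u u′} (l≤Mt : l ≤ M * t) (u∈ : InInterval a l u) (u′∈ : InInterval a l u′) →
    chunk M l≤Mt u∈ ≡ chunk M l≤Mt u′∈ → u < u′ + t
  chunk-close M {u} {u′} l≤Mt (a≤u , _) (a≤u′ , _) e = begin-strict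
    u                ≡⟨ sym (m+[n∸m]≡n a≤u) ⟩
    a + w            <⟨ +-monoʳ-< a w<t+qt ⟩
    a + (t + q * t)  ≤⟨ +-monoʳ-≤ a (+-monoʳ-≤ t qt≤w′) ⟩
    a + (t + w′)     ≡⟨ cong (a +_) (+-comm t w′) ⟩
    a + (w′ + t)     ≡⟨ sym (+-assoc a w′ t) ⟩
    a + w′ + t       ≡⟨ cong (_+ t) (m+[n∸m]≡n a≤u′) ⟩
    u′ + t           ∎
    where
    open ≤-Reasoning
    w = u ∸ a
    w′ = u′ ∸ a
    q = w / t
    same-quotient : q ≡ w′ / t
    same-quotient = trans (sym (toℕ-fromℕ< _)) (trans (cong toℕ e) (toℕ-fromℕ< _))
    w<t+qt : w < t + q * t
    w<t+qt = begin-strict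
      w              ≡⟨ m≡m%n+[m/n]*n w t ⟩
      w % t + q * t  <⟨ +-monoˡ-< (q * t) (m%n<n w t) ⟩
      t + q * t      ∎
    qt≤w′ : q * t ≤ w′
    qt≤w′ = subst (λ q → q * t ≤ w′) (sym same-quotient) (m/n*n≤m w′ t)

module _ {n : ℕ} {S : ℕ → Set} where

  OrderIso-≮-above-agreement : ∀ {f g} → OrderIso n S f → OrderIso n S g → ∀ {p} → 1 ≤ p → p ≤ n →
    (∀ {p′} → 1 ≤ p′ → p′ < p → f p′ ≡ g p′) → ¬ f p < g p
  OrderIso-≮-above-agreement {f} {g} (f-mono , f∈S , _) (g-mono , _ , g-onto) {p} 1≤p p≤n agree fp<gp
    with g-onto (f p) (f∈S p 1≤p p≤n)
  ... | p′ , 1≤p′ , p′≤n , gp′≡fp with <-cmp p′ p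
  ... | tri< p′<p _ _ = <-irrefl (trans (agree 1≤p′ p′<p) gp′≡fp) (f-mono p′ p 1≤p′ p′<p p≤n)
  ... | tri≈ _ refl _ = <-irrefl (sym gp′≡fp) fp<gp
  ... | tri> _ _ p<p′ = <-asym fp<gp (subst (g p <_) gp′≡fp (g-mono p p′ 1≤p p<p′ p′≤n))

  OrderIso-unique : ∀ {f g} → OrderIso n S f → OrderIso n S g → ∀ p → 1 ≤ p → p ≤ n → f p ≡ g p
  OrderIso-unique {f} {g} F G = <-rec _ agree
    where
    agree : ∀ p → (∀ {p′} → p′ < p → 1 ≤ p′ → p′ ≤ n → f p′ ≡ g p′) → 1 ≤ p → p ≤ n → f p ≡ g p
    agree p ih 1≤p p≤n with <-cmp (f p) (g p)
    ... | tri≈ _ fp≡gp _ = fp≡gp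
    ... | tri< fp<gp _ _ = contradiction fp<gp
      (OrderIso-≮-above-agreement F G 1≤p p≤n (λ 1≤p′ p′<p → ih p′<p 1≤p′ (≤-trans (<⇒≤ p′<p) p≤n)))
    ... | tri> _ _ gp<fp = contradiction gp<fp
      (OrderIso-≮-above-agreement G F 1≤p p≤n (λ 1≤p′ p′<p → sym (ih p′<p 1≤p′ (≤-trans (<⇒≤ p′<p) p≤n))))

-- The position of j in ℕ ∖ {i}, i.e. Data.Fin's punchOut on ℕ.
index : ℕ → ℕ → ℕ
index zero    zero    = zero
index zero    (suc j) = j
index (suc i) zero    = zero
index (suc i) (suc j) = suc (index i j)

index-below : ∀ {i j} → j < i → index i j ≡ j
index-below {suc i} {zero}  _         = refl
index-below {suc i} {suc j} (s≤s j<i) = cong suc (index-below j<i)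

index-above : ∀ {i j} → i ≤ j → index i (suc j) ≡ j
index-above {zero}  {j}     _         = refl
index-above {suc i} {suc j} (s≤s i≤j) = cong suc (index-above i≤j)

index-< : ∀ {i j n} → i ≢ j → i ≤ n → j ≤ n → index i j < n
index-< {i} {j} i≢j i≤n j≤n with <-cmp i j
... | tri< (s≤s i≤j′) _ _ = subst (_< _) (sym (index-above i≤j′)) j≤n
... | tri≈ _ i≡j _ = contradiction i≡j i≢j
... | tri> _ _ j<i = subst (_< _) (sym (index-below j<i)) (<-≤-trans j<i i≤n)

aElem-index : ∀ {i j} → i ≢ j → aElem (suc i) (index i j) (suc j)
aElem-index {i} {j} i≢j with <-cmp i j
... | tri< (s≤s {n = j′} i≤j′) _ _ rewrite index-above i≤j′ =
  inj₂ (≤-trans (s≤s i≤j′) (≤-reflexive (+-comm 1 j′)) , sym (+-comm j′ 2))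
... | tri≈ _ i≡j _ = contradiction i≡j i≢j
... | tri> _ _ j<i rewrite index-below j<i =
  inj₁ (subst (_< suc i) (+-comm 1 j) (s≤s j<i) , +-comm 1 j)

aElem⇒index : ∀ {i j x} → aElem (suc i) x (suc j) → x ≡ index i j
aElem⇒index {i} {x = x} (inj₁ (x+1<1+i , 1+j≡x+1))
  with refl ← suc-injective (trans 1+j≡x+1 (+-comm x 1)) =
  sym (index-below (≤-pred (subst (_< suc i) (+-comm x 1) x+1<1+i)))
aElem⇒index {i} {x = x} (inj₂ (1+i≤x+1 , 1+j≡x+2))
  with refl ← suc-injective (trans 1+j≡x+2 (+-comm x 2)) =
  sym (index-above (≤-pred (≤-trans 1+i≤x+1 (≤-reflexive (+-comm x 1)))))

MtArc-intro : ∀ {t r₁ r₂} → r₁ < t → r₂ < t → MtArc t (suc (r₁ * t + r₂)) (suc (t * t + (r₂ * t + r₁)))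
MtArc-intro {t} {r₁} {r₂} r₁<t r₂<t =
  suc r₁ , suc r₂ , s≤s z≤n , r₁<t , s≤s z≤n , r₂<t ,
  sym (+-suc (r₁ * t) r₂) ,
  sym (trans (+-suc (t * t + r₂ * t) r₁) (cong suc (+-assoc (t * t) (r₂ * t) r₁)))

MtArc-elim : ∀ {t p q} → MtArc t p q →
  ∃₂ λ r₁ r₂ → r₁ < t × r₂ < t × p ≡ suc (r₁ * t + r₂) × q ≡ suc (t * t + (r₂ * t + r₁))
MtArc-elim {t} (suc r₁ , suc r₂ , _ , r₁<t , _ , r₂<t , refl , refl) =
  r₁ , r₂ , r₁<t , r₂<t , +-suc (r₁ * t) r₂ ,
  trans (+-suc (t * t + r₂ * t) r₁) (cong suc (+-assoc (t * t) (r₂ * t) r₁))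

Edge-sym : ∀ {k t u v} → Edge k t u v → Edge k t v u
Edge-sym (i , j , 1≤i , i<j , j≤k , f , iso , p , q , pq , fp≡u , fq≡v) =
  i , j , 1≤i , i<j , j≤k , f , iso , q , p , swap pq , fq≡v , fp≡u

InP-injective : ∀ {k t i j u} → InP k t (suc i) u → InP k t (suc j) u → i ≡ j
InP-injective {k} {t} {i} {j} (iN+1≤u , u≤[1+i]N) (jN+1≤u , u≤[1+j]N) =
  ≤-antisym (≤-pred (*-cancelʳ-< N i (suc j) (<-≤-trans (below iN+1≤u) u≤[1+j]N)))
            (≤-pred (*-cancelʳ-< N j (suc i) (<-≤-trans (below jN+1≤u) u≤[1+i]N)))
  where
  N = (k ∸ 1) * (t * t)
  below : ∀ {x u} → x + 1 ≤ u → x < u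
  below {x} = ≤-trans (≤-reflexive (+-comm 1 x))

InP-ordered : ∀ {k t i j u v} → i < j → InP k t (suc i) u → InP k t (suc j) v → u < v
InP-ordered {k} {t} {i} {j} {u} {v} i<j (_ , u≤[1+i]N) (jN+1≤v , _) = begin-strict
  u          ≤⟨ u≤[1+i]N ⟩
  suc i * N  ≤⟨ *-monoˡ-≤ N i<j ⟩
  j * N      <⟨ ≤-trans (≤-reflexive (+-comm 1 (j * N))) jN+1≤v ⟩
  v          ∎
  where
  open ≤-Reasoning
  N = (k ∸ 1) * (t * t)

-- k = 3 + κ and K = k − 1.  Parts, blocks and positions are 0-indexed: partVertex i x is vertex x of
-- P_{i+1}, and blockVertex i d r s is vertex s of the block B_{i+1,ℓ} with ℓ = d + rK + 1.
module Construction (κ t : ℕ) .{{_ : NonZero t}} where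

  k K T N : ℕ
  k = 3 + κ
  K = 2 + κ
  T = t * t
  N = K * T

  partVertex : ℕ → ℕ → ℕ
  partVertex i x = suc (i * N + x)

  blockVertex : ℕ → ℕ → ℕ → ℕ → ℕ
  blockVertex i d r s = partVertex i ((d + r * K) * t + s)

  partVertex-InP : ∀ {i x} → x < N → InP k t (suc i) (partVertex i x)
  partVertex-InP {i} {x} x<N =
    ≤-trans (≤-reflexive (+-comm (i * N) 1)) (s≤s (m≤m+n (i * N) x)) ,
    ≤-trans (≤-reflexive (sym (+-suc (i * N) x))) (≤-trans (+-monoʳ-≤ (i * N) x<N) (≤-reflexive (+-comm (i * N) N)))

  InP⇒partVertex : ∀ {i u} → InP k t (suc i) u → ∃[ x ] (x < N × u ≡ partVertex i x)
  InP⇒partVertex {i} (iN+1≤u , u≤[1+i]N) = bounded⇒offset iN+1≤u (≤-trans u≤[1+i]N (≤-reflexive (+-comm N (i * N))))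

  partVertex-∈ : ∀ {i a x l} → a ≤ x → x < a + l → InInterval (partVertex i a) l (partVertex i x)
  partVertex-∈ {i} {a} {x} {l} a≤x x<a+l =
    s≤s (+-monoʳ-≤ (i * N) a≤x) ,
    s≤s (≤-trans (+-monoʳ-< (i * N) x<a+l) (≤-reflexive (sym (+-assoc (i * N) a l))))

  block<Kt : ∀ {d r} → d < K → r < t → d + r * K < K * t
  block<Kt {d} {r} d<K r<t = begin-strict
    d + r * K  <⟨ +-monoˡ-< (r * K) d<K ⟩
    K + r * K  ≤⟨ *-monoˡ-≤ K r<t ⟩
    t * K      ≡⟨ *-comm t K ⟩
    K * t      ∎
    where open ≤-Reasoning

  block<Kt⁻¹ : ∀ {d r} → d + r * K < K * t → r < t
  block<Kt⁻¹ {d} {r} b<Kt = *-cancelʳ-< K r t (begin-strict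
    r * K      ≤⟨ m≤n+m (r * K) d ⟩
    d + r * K  <⟨ b<Kt ⟩
    K * t      ≡⟨ *-comm K t ⟩
    t * K      ∎)
    where open ≤-Reasoning

  blockVertex-InP : ∀ {i d r s} → d < K → r < t → s < t → InP k t (suc i) (blockVertex i d r s)
  blockVertex-InP {i} d<K r<t s<t =
    partVertex-InP {i} (≤-trans (m*n+o<p*n (block<Kt d<K r<t) s<t) (≤-reflexive (*-assoc K t t)))

  blockVertex-InB : ∀ {i d r s} → d < K → r < t → s < t → InB k t (suc i) (suc (d + r * K)) (blockVertex i d r s)
  blockVertex-InB {i} {d} {r} {s} d<K r<t s<t = s≤s z≤n , block<Kt d<K r<t , lower , upper
    where
    open ≤-Reasoning
    b = d + r * K
    lower : i * N + b * t + 1 ≤ blockVertex i d r s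
    lower = begin
      i * N + b * t + 1        ≡⟨ +-comm (i * N + b * t) 1 ⟩
      suc (i * N + b * t)      ≤⟨ s≤s (m≤m+n _ s) ⟩
      suc (i * N + b * t + s)  ≡⟨ cong suc (+-assoc (i * N) (b * t) s) ⟩
      blockVertex i d r s      ∎
    upper : blockVertex i d r s ≤ i * N + suc b * t
    upper = begin
      suc (i * N + (b * t + s))  ≡⟨ sym (+-suc (i * N) (b * t + s)) ⟩
      i * N + suc (b * t + s)    ≡⟨ cong (i * N +_) (sym (+-suc (b * t) s)) ⟩
      i * N + (b * t + suc s)    ≤⟨ +-monoʳ-≤ (i * N) (+-monoʳ-≤ (b * t) s<t) ⟩
      i * N + (b * t + t)        ≡⟨ cong (i * N +_) (+-comm (b * t) t) ⟩
      i * N + suc b * t          ∎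

  InB⇒blockVertex : ∀ {i d r u} → InB k t (suc i) (suc (d + r * K)) u →
    r < t × ∃[ s ] (s < t × u ≡ blockVertex i d r s)
  InB⇒blockVertex {i} {d} {r} {u} (_ , b<Kt , lower , upper) =
    let s , s<t , u≡ = bounded⇒offset lower (≤-trans upper (≤-reflexive shift))
    in block<Kt⁻¹ b<Kt , s , s<t , trans u≡ (cong suc (+-assoc (i * N) ((d + r * K) * t) s))
    where
    shift : i * N + suc (d + r * K) * t ≡ i * N + (d + r * K) * t + t
    shift = trans (cong (i * N +_) (+-comm t _)) (sym (+-assoc (i * N) _ t))

  blockVertex-/%-monotone : ∀ i d {m m′} → m < m′ →
    blockVertex i d (m / t) (m % t) < blockVertex i d (m′ / t) (m′ % t)
  blockVertex-/%-monotone i d {m} {m′} m<m′ =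
    s≤s (+-monoʳ-< (i * N) (begin-strict
      offset m                         ≡⟨ unfold m ⟩
      d * t + m / t * suc κ * t + m    <⟨ +-mono-≤-< (+-monoʳ-≤ (d * t) skip≤skip′) m<m′ ⟩
      d * t + m′ / t * suc κ * t + m′  ≡⟨ unfold m′ ⟨
      offset m′                        ∎))
    where
    open ≤-Reasoning
    offset : ℕ → ℕ
    offset n = (d + n / t * K) * t + n % t
    regroup : ∀ d q c t s → (d + q * (2 + c)) * t + s ≡ d * t + q * suc c * t + (s + q * t)
    regroup = solve-∀
    unfold : ∀ n → offset n ≡ d * t + n / t * suc κ * t + n
    unfold n = trans (regroup d (n / t) κ t (n % t)) (cong (d * t + n / t * suc κ * t +_) (sym (m≡m%n+[m/n]*n n t)))
    skip≤skip′ : m / t * suc κ * t ≤ m′ / t * suc κ * t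
    skip≤skip′ = *-monoˡ-≤ t (*-monoˡ-≤ (suc κ) (/-monoˡ-≤ t (<⇒≤ m<m′)))

  -- This is where k ≥ 3 is needed: with K ≥ 2 the blocks of one superblock are never adjacent.
  blockVertex-separated : ∀ {i d r r′ s s′} → r < r′ → s < t → blockVertex i d r s + t ≤ blockVertex i d r′ s′
  blockVertex-separated {i} {d} {r} {r′} {s} {s′} r<r′ s<t = s≤s (begin
    i * N + (b * t + s) + t    ≡⟨ +-assoc (i * N) (b * t + s) t ⟩
    i * N + (b * t + s + t)    ≤⟨ +-monoʳ-≤ (i * N) (begin
      b * t + s + t              ≤⟨ +-monoˡ-≤ t (+-monoʳ-≤ (b * t) (<⇒≤ s<t)) ⟩
      b * t + t + t              ≡⟨ two-more b t ⟩
      (2 + b) * t                ≤⟨ *-monoˡ-≤ t 2+b≤b′ ⟩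
      b′ * t                     ≤⟨ m≤m+n (b′ * t) s′ ⟩
      b′ * t + s′                ∎) ⟩
    i * N + (b′ * t + s′)      ∎)
    where
    open ≤-Reasoning
    b = d + r * K
    b′ = d + r′ * K
    two-more : ∀ b t → b * t + t + t ≡ (2 + b) * t
    two-more = solve-∀
    2+b≤b′ : 2 + b ≤ b′
    2+b≤b′ = begin
      2 + (d + r * K)  ≡⟨ sym (trans (+-suc d (suc (r * K))) (cong suc (+-suc d (r * K)))) ⟩
      d + (2 + r * K)  ≤⟨ +-monoʳ-≤ d (+-monoˡ-≤ (r * K) (s≤s (s≤s z≤n))) ⟩
      d + suc r * K    ≤⟨ +-monoʳ-≤ d (*-monoˡ-≤ K r<r′) ⟩
      b′               ∎

  blockVertex-close⇒same-block : ∀ {i d r r′ s s′} → s < t → s′ < t →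
    blockVertex i d r s < blockVertex i d r′ s′ + t → blockVertex i d r′ s′ < blockVertex i d r s + t → r ≡ r′
  blockVertex-close⇒same-block {i} {d} {r} {r′} {s} {s′} s<t s′<t u<u′+t u′<u+t with <-cmp r r′
  ... | tri< r<r′ _ _ = contradiction (<-≤-trans u′<u+t (blockVertex-separated {i} {d} {s′ = s′} r<r′ s<t)) (<-irrefl refl)
  ... | tri≈ _ r≡r′ _ = r≡r′
  ... | tri> _ _ r′<r = contradiction (<-≤-trans u<u′+t (blockVertex-separated {i} {d} {s′ = s} r′<r s′<t)) (<-irrefl refl)

  -- The blocks ℓ ≡ j (mod K) are those with ℓ = residue j + rK + 1.
  residue : ℕ → ℕ
  residue zero    = suc κ
  residue (suc j) = j

  residue-< : ∀ {j} → j < K → residue j < K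
  residue-< {zero}  _     = ≤-refl
  residue-< {suc j} j+1<K = <-trans (n<1+n j) j+1<K

  block-of-residue : ∀ j r → ∃[ r′ ] suc (residue j + r * K) ≡ j + r′ * K
  block-of-residue zero    r = suc r , refl
  block-of-residue (suc j) r = r , refl

  residue-of-block : ∀ j r′ → 1 ≤ j + r′ * K → ∃[ r ] j + r′ * K ≡ suc (residue j + r * K)
  residue-of-block zero    (suc r) _ = r , refl
  residue-of-block (suc j) r′      _ = r′ , refl

  superblockVertex : ℕ → ℕ → ℕ → ℕ → ℕ
  superblockVertex i j = blockVertex i (residue (index i j))

  residue-index-< : ∀ {i j} → i ≢ j → i ≤ K → j ≤ K → residue (index i j) < K
  residue-index-< i≢j i≤K j≤K = residue-< (index-< i≢j i≤K j≤K)

  superblockVertex-InP : ∀ {i j r s} → i ≢ j → i ≤ K → j ≤ K → r < t → s < t →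
    InP k t (suc i) (superblockVertex i j r s)
  superblockVertex-InP {i} i≢j i≤K j≤K = blockVertex-InP {i} (residue-index-< i≢j i≤K j≤K)

  superblockVertex-InC : ∀ {i j r s} → i ≢ j → i ≤ K → j ≤ K → r < t → s < t →
    InC k t (suc i) (suc j) (superblockVertex i j r s)
  superblockVertex-InC {i} {j} {r} i≢j i≤K j≤K r<t s<t =
    index i j , index-< i≢j i≤K j≤K , aElem-index i≢j ,
    _ , block-of-residue (index i j) r , blockVertex-InB {i} (residue-index-< i≢j i≤K j≤K) r<t s<t

  InC⇒superblockVertex : ∀ {i j u} → InC k t (suc i) (suc j) u →
    ∃₂ λ r s → r < t × s < t × u ≡ superblockVertex i j r s
  InC⇒superblockVertex {i} {u = u} (x , _ , x∈ , _ , (r′ , refl) , u∈B)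
    with refl ← aElem⇒index x∈
    with r , ℓ≡ ← residue-of-block x r′ (proj₁ u∈B)
    with r<t , s , s<t , refl ← InB⇒blockVertex {i} {residue x} {r} (subst (λ ℓ → InB k t (suc i) ℓ u) ℓ≡ u∈B) =
    r , s , r<t , s<t , refl

  superblockAt : ℕ → ℕ → ℕ → ℕ
  superblockAt i j m = superblockVertex i j (m / t) (m % t)

  superblockAt-digits : ∀ {i j r s} → s < t → superblockAt i j (r * t + s) ≡ superblockVertex i j r s
  superblockAt-digits {i} {j} {r} s<t = cong₂ (superblockVertex i j) ([m*n+o]/n≡m r s<t) ([m*n+o]%n≡o r s<t)

  superblockAt-InC : ∀ {i j m} → i ≢ j → i ≤ K → j ≤ K → m < T → InC k t (suc i) (suc j) (superblockAt i j m)
  superblockAt-InC {m = m} i≢j i≤K j≤K m<T = superblockVertex-InC i≢j i≤K j≤K (m<n*o⇒m/o<n m<T) (m%n<n m t)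

  superblockAt-InP : ∀ {i j m} → i ≢ j → i ≤ K → j ≤ K → m < T → InP k t (suc i) (superblockAt i j m)
  superblockAt-InP {m = m} i≢j i≤K j≤K m<T = superblockVertex-InP i≢j i≤K j≤K (m<n*o⇒m/o<n m<T) (m%n<n m t)

  lower-half : ∀ {m} → m < T → suc m ≤ 2 * T
  lower-half m<T = ≤-trans m<T (m≤m+n T (T + 0))

  upper-half : ∀ {m} → m < T → suc (T + m) ≤ 2 * T
  upper-half {m} m<T = ≤-trans (≤-reflexive (sym (+-suc T m))) (+-monoʳ-≤ T (≤-trans m<T (≤-reflexive (sym (+-identityʳ T)))))

  upper-half⁻¹ : ∀ {m} → ¬ m < T → suc m ≤ 2 * T → m ∸ T < T
  upper-half⁻¹ {m} m≮T m<2T = subst (m ∸ T <_) (m+n∸m≡n T T)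
    (∸-monoˡ-< (≤-trans m<2T (≤-reflexive (cong (T +_) (+-identityʳ T)))) (≮⇒≥ m≮T))

  -- copy i j p is the p-th vertex (p ≥ 1) of C_{i+1,j+1} ∪ C_{j+1,i+1}; copy i j 0 is junk.
  copy : ℕ → ℕ → ℕ → ℕ
  copy i j zero    = zero
  copy i j (suc m) with m <? T
  ... | yes _ = superblockAt i j m
  ... | no  _ = superblockAt j i (m ∸ T)

  copy-lower : ∀ {i j m} → m < T → copy i j (suc m) ≡ superblockAt i j m
  copy-lower {m = m} m<T with m <? T
  ... | yes _    = refl
  ... | no  m≮T = contradiction m<T m≮T

  copy-upper : ∀ {i j m} → copy i j (suc (T + m)) ≡ superblockAt j i m
  copy-upper {i} {j} {m} with T + m <? T
  ... | yes T+m<T = contradiction T+m<T (≤⇒≯ (m≤m+n T m))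
  ... | no  _     = cong (superblockAt j i) (m+n∸m≡n T m)

  copy-arc-source : ∀ {i j r₁ r₂} → r₁ < t → r₂ < t → copy i j (suc (r₁ * t + r₂)) ≡ superblockVertex i j r₁ r₂
  copy-arc-source {i} {j} {r₁} r₁<t r₂<t = trans (copy-lower (m*n+o<p*n r₁<t r₂<t)) (superblockAt-digits {i} {j} {r₁} r₂<t)

  copy-arc-target : ∀ {i j r₁ r₂} → r₁ < t → r₂ < t → copy i j (suc (T + (r₂ * t + r₁))) ≡ superblockVertex j i r₂ r₁
  copy-arc-target {i} {j} {r₂ = r₂} r₁<t r₂<t = trans (copy-upper {i} {j}) (superblockAt-digits {j} {i} {r₂} r₁<t)

  CopyDomain : ℕ → ℕ → ℕ → Set
  CopyDomain i j w = InC k t (suc i) (suc j) w ⊎ InC k t (suc j) (suc i) w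

  copy-OrderIso : ∀ {i j} → i < j → j ≤ K → OrderIso (2 * T) (CopyDomain i j) (copy i j)
  copy-OrderIso {i} {j} i<j j≤K = monotone , into , onto
    where
    i≢j = <⇒≢ i<j
    i≤K = <⇒≤ (<-≤-trans i<j j≤K)

    monotone : ∀ p q → 1 ≤ p → p < q → q ≤ 2 * T → copy i j p < copy i j q
    monotone (suc m) (suc m′) _ (s≤s m<m′) m′<2T with m <? T | m′ <? T
    ... | yes _   | yes _    = blockVertex-/%-monotone i (residue (index i j)) m<m′
    ... | yes m<T | no  m′≮T = InP-ordered {k} {t} i<j (superblockAt-InP {i} {j} i≢j i≤K j≤K m<T)
                                 (superblockAt-InP {j} {i} (i≢j ∘ sym) j≤K i≤K (upper-half⁻¹ m′≮T m′<2T))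
    ... | no  m≮T | yes m′<T = contradiction (<-trans m<m′ m′<T) m≮T
    ... | no  m≮T | no  _    = blockVertex-/%-monotone j (residue (index j i)) (∸-monoˡ-< m<m′ (≮⇒≥ m≮T))

    into : ∀ p → 1 ≤ p → p ≤ 2 * T → CopyDomain i j (copy i j p)
    into (suc m) _ m<2T with m <? T
    ... | yes m<T = inj₁ (superblockAt-InC {i} {j} i≢j i≤K j≤K m<T)
    ... | no  m≮T = inj₂ (superblockAt-InC {j} {i} (i≢j ∘ sym) j≤K i≤K (upper-half⁻¹ m≮T m<2T))

    onto : ∀ u → CopyDomain i j u → ∃[ p ] (1 ≤ p × p ≤ 2 * T × copy i j p ≡ u)
    onto u (inj₁ u∈C) with r , s , r<t , s<t , refl ← InC⇒superblockVertex u∈C =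
      suc (r * t + s) , s≤s z≤n , lower-half (m*n+o<p*n r<t s<t) , copy-arc-source {i} {j} r<t s<t
    onto u (inj₂ u∈C) with r , s , r<t , s<t , refl ← InC⇒superblockVertex u∈C =
      suc (T + (r * t + s)) , s≤s z≤n , upper-half (m*n+o<p*n r<t s<t) , copy-arc-target {i} {j} s<t r<t

  record SuperblockEdge (i j u v : ℕ) : Set where
    constructor superblockEdge
    field
      {r₁ r₂} : ℕ
      r₁<t : r₁ < t
      r₂<t : r₂ < t
      source : u ≡ superblockVertex i j r₁ r₂
      target : v ≡ superblockVertex j i r₂ r₁

  SuperblockEdge-sym : ∀ {i j u v} → SuperblockEdge i j u v → SuperblockEdge j i v u
  SuperblockEdge-sym (superblockEdge r₁<t r₂<t u≡ v≡) = superblockEdge r₂<t r₁<t v≡ u≡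

  copy-SuperblockEdge : ∀ {i j u v} → i < j → j ≤ K → SuperblockEdge i j u v → Edge k t u v
  copy-SuperblockEdge {i} {j} i<j j≤K (superblockEdge r₁<t r₂<t refl refl) =
    suc i , suc j , s≤s z≤n , s≤s i<j , s≤s j≤K , copy i j , copy-OrderIso i<j j≤K ,
    _ , _ , inj₁ (MtArc-intro r₁<t r₂<t) , copy-arc-source {i} {j} r₁<t r₂<t , copy-arc-target {i} {j} r₁<t r₂<t

  SuperblockEdge⇒Edge : ∀ {i j u v} → i ≢ j → i ≤ K → j ≤ K → SuperblockEdge i j u v → Edge k t u v
  SuperblockEdge⇒Edge {i} {j} i≢j i≤K j≤K e with <-cmp i j
  ... | tri< i<j _ _ = copy-SuperblockEdge i<j j≤K e
  ... | tri≈ _ i≡j _ = contradiction i≡j i≢j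
  ... | tri> _ _ j<i = Edge-sym (copy-SuperblockEdge j<i i≤K (SuperblockEdge-sym e))

  OrderIso-MtArc⇒SuperblockEdge : ∀ {i j f p q} → i < j → j ≤ K → OrderIso (2 * T) (CopyDomain i j) f →
    MtArc t p q → SuperblockEdge i j (f p) (f q)
  OrderIso-MtArc⇒SuperblockEdge {i} {j} {f} i<j j≤K f-iso pq
    with r₁ , r₂ , r₁<t , r₂<t , refl , refl ← MtArc-elim pq =
    superblockEdge r₁<t r₂<t
    (trans (f≡copy (lower-half (m*n+o<p*n r₁<t r₂<t))) (copy-arc-source {i} {j} r₁<t r₂<t))
    (trans (f≡copy (upper-half (m*n+o<p*n r₂<t r₁<t))) (copy-arc-target {i} {j} r₁<t r₂<t))
    where
    f≡copy : ∀ {m} → suc m ≤ 2 * T → f (suc m) ≡ copy i j (suc m)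
    f≡copy m<2T = OrderIso-unique f-iso (copy-OrderIso i<j j≤K) _ (s≤s z≤n) m<2T

  SuperblockEdge-located : ∀ {x y i j u v} → x ≢ y → x ≤ K → y ≤ K → SuperblockEdge x y u v →
    InP k t (suc i) u → InP k t (suc j) v → SuperblockEdge i j u v
  SuperblockEdge-located {x} {y} {i} {j} x≢y x≤K y≤K e@(superblockEdge r₁<t r₂<t refl refl) u∈Pi v∈Pj
    with refl ← InP-injective {k} {t} {i} {x} u∈Pi (superblockVertex-InP {x} {y} x≢y x≤K y≤K r₁<t r₂<t)
    with refl ← InP-injective {k} {t} {j} {y} v∈Pj (superblockVertex-InP {y} {x} (x≢y ∘ sym) y≤K x≤K r₂<t r₁<t) = e

  Edge⇒SuperblockEdge : ∀ {i j u v} → InP k t (suc i) u → InP k t (suc j) v → Edge k t u v → SuperblockEdge i j u v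
  Edge⇒SuperblockEdge u∈Pi v∈Pj (suc x , suc y , _ , s≤s x<y , s≤s y≤K , f , f-iso , p , q , inj₁ pq , refl , refl) =
    SuperblockEdge-located (<⇒≢ x<y) (<⇒≤ (<-≤-trans x<y y≤K)) y≤K
      (OrderIso-MtArc⇒SuperblockEdge x<y y≤K f-iso pq) u∈Pi v∈Pj
  Edge⇒SuperblockEdge u∈Pi v∈Pj (suc x , suc y , _ , s≤s x<y , s≤s y≤K , f , f-iso , p , q , inj₂ qp , refl , refl) =
    SuperblockEdge-located (<⇒≢ x<y ∘ sym) y≤K (<⇒≤ (<-≤-trans x<y y≤K))
      (SuperblockEdge-sym (OrderIso-MtArc⇒SuperblockEdge x<y y≤K f-iso qp)) u∈Pi v∈Pj

  IntervalSubP⇒offset : ∀ {i a l} → IntervalSubP k t (suc i) a l → 0 < l → ∃[ a′ ] (a ≡ partVertex i a′ × a′ + l ≤ N)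
  IntervalSubP⇒offset {i} {a} {suc l} I⊆P _
    with a′ , _ , refl ← InP⇒partVertex {i} (I⊆P a (≤-refl , m<m+n a (s≤s z≤n)))
    with x , x<N , last≡ ← InP⇒partVertex {i} (I⊆P (a + l) (m≤m+n a l , +-monoʳ-< a ≤-refl)) =
    a′ , refl , ≤-trans (≤-reflexive (trans (+-suc a′ l) (cong suc a′+l≡x))) x<N
    where
    a′+l≡x : a′ + l ≡ x
    a′+l≡x = +-cancelˡ-≡ (i * N) _ _ (trans (sym (+-assoc (i * N) a′ l)) (suc-injective last≡))

  long-interval-contains-block : ∀ {i a l d} → IntervalSubP k t (suc i) a l → k * t ≤ l → d < K →
    ∃[ r ] (r < t × ∀ {s} → s < t → InInterval a l (blockVertex i d r s))
  long-interval-contains-block {i} {a} {l} {d} I⊆P kt≤l d<K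
    with a′ , refl , a′+l≤N ← IntervalSubP⇒offset {i} I⊆P (≤-trans (≤-trans (>-nonZero⁻¹ t) (m≤m+n t (K * t))) kt≤l)
    with r , q<b , b≤q+K ← window-contains-residue d<K (a′ / t) =
    r , block<Kt⁻¹ b<Kt , λ s<t → partVertex-∈ {i} (≤-trans a′≤bt (m≤m+n _ _)) (<-≤-trans (+-monoʳ-< (b * t) s<t) bt+t≤a′+l)
    where
    open ≤-Reasoning
    q = a′ / t
    b = d + r * K
    a′≤bt : a′ ≤ b * t
    a′≤bt = begin
      a′             ≡⟨ m≡m%n+[m/n]*n a′ t ⟩
      a′ % t + q * t ≤⟨ +-monoˡ-≤ (q * t) (<⇒≤ (m%n<n a′ t)) ⟩
      suc q * t      ≤⟨ *-monoˡ-≤ t q<b ⟩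
      b * t          ∎
    bt+t≤a′+l : b * t + t ≤ a′ + l
    bt+t≤a′+l = begin
      b * t + t      ≡⟨ +-comm (b * t) t ⟩
      suc b * t      ≤⟨ *-monoˡ-≤ t (≤-trans (s≤s b≤q+K) (≤-reflexive (sym (+-suc q K)))) ⟩
      (q + k) * t    ≡⟨ *-distribʳ-+ t q k ⟩
      q * t + k * t  ≤⟨ +-mono-≤ (m/n*n≤m a′ t) kt≤l ⟩
      a′ + l         ∎
    b<Kt : b < K * t
    b<Kt = *-cancelʳ-≤ (suc b) (K * t) t (begin
      suc b * t      ≡⟨ +-comm t (b * t) ⟩
      b * t + t      ≤⟨ bt+t≤a′+l ⟩
      a′ + l         ≤⟨ a′+l≤N ⟩
      K * (t * t)    ≡⟨ *-assoc K t t ⟨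
      K * t * t      ∎)

  edge-between-long-intervals : ∀ {i j a la b lb} → i ≢ j → i ≤ K → j ≤ K →
    IntervalSubP k t (suc i) a la → IntervalSubP k t (suc j) b lb → k * t ≤ la → k * t ≤ lb →
    ∃[ u ] ∃[ v ] (InInterval a la u × InInterval b lb v × Edge k t u v)
  edge-between-long-intervals {i} {j} i≢j i≤K j≤K I⊆Pi J⊆Pj kt≤la kt≤lb
    with r₁ , r₁<t , block₁⊆I ← long-interval-contains-block {i} I⊆Pi kt≤la (residue-index-< i≢j i≤K j≤K)
    with r₂ , r₂<t , block₂⊆J ← long-interval-contains-block {j} J⊆Pj kt≤lb (residue-index-< (i≢j ∘ sym) j≤K i≤K) =
    superblockVertex i j r₁ r₂ , superblockVertex j i r₂ r₁ , block₁⊆I r₂<t , block₂⊆J r₁<t ,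
    SuperblockEdge⇒Edge i≢j i≤K j≤K (superblockEdge r₁<t r₂<t refl refl)

  same-chunk⇒same-block : ∀ i j {a l} r r′ {s s′} (l≤ : l ≤ 2 * k * t) →
    (u∈ : InInterval a l (superblockVertex i j r s)) (u′∈ : InInterval a l (superblockVertex i j r′ s′)) →
    s < t → s′ < t → chunk (2 * k) l≤ u∈ ≡ chunk (2 * k) l≤ u′∈ → r ≡ r′
  same-chunk⇒same-block i j r r′ {s} {s′} l≤ u∈ u′∈ s<t s′<t same-chunk =
    blockVertex-close⇒same-block {i} {residue (index i j)} {r} {r′} {s} {s′} s<t s′<t
      (chunk-close (2 * k) l≤ u∈ u′∈ same-chunk) (chunk-close (2 * k) l≤ u′∈ u∈ (sym same-chunk))

  EdgeBetween : ℕ → ℕ → ℕ → ℕ → ℕ × ℕ → Set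
  EdgeBetween a la b lb (u , v) = InInterval a la u × InInterval b lb v × Edge k t u v

  edges-between-short-intervals : ∀ {i j a la b lb es} →
    IntervalSubP k t (suc i) a la → IntervalSubP k t (suc j) b lb → la ≤ 2 * k * t → lb ≤ 2 * k * t →
    Unique es → All (EdgeBetween a la b lb) es → length es ≤ 2 * k * (2 * k)
  edges-between-short-intervals {i} {j} {a} {la} {b} {lb} I⊆Pi J⊆Pj la≤ lb≤ =
    Unique-length≤ key key-injective
    where
    key : ∀ {e} → EdgeBetween a la b lb e → Fin (2 * k * (2 * k))
    key {u , v} (u∈I , v∈J , _) = combine (chunk (2 * k) la≤ u∈I) (chunk (2 * k) lb≤ v∈J)

    key-injective : ∀ {e e′} (p : EdgeBetween a la b lb e) (p′ : EdgeBetween a la b lb e′) → key p ≡ key p′ → e ≡ e′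
    key-injective {u , v} {u′ , v′} (u∈I , v∈J , uv) (u′∈I , v′∈J , u′v′) same-key
      with superblockEdge {r₁} {r₂} r₁<t r₂<t refl refl ← Edge⇒SuperblockEdge {i} {j} (I⊆Pi u u∈I) (J⊆Pj v v∈J) uv
      with superblockEdge {r₁′} {r₂′} r₁′<t r₂′<t refl refl ← Edge⇒SuperblockEdge {i} {j} (I⊆Pi u′ u′∈I) (J⊆Pj v′ v′∈J) u′v′
      with same-u-chunk , same-v-chunk ← combine-injective _ _ _ _ same-key
      with refl ← same-chunk⇒same-block i j r₁ r₁′ la≤ u∈I u′∈I r₂<t r₂′<t same-u-chunk
      with refl ← same-chunk⇒same-block j i r₂ r₂′ lb≤ v∈J v′∈J r₁<t r₁′<t same-v-chunk = refl

lemma4 : (k t : ℕ) → 3 ≤ k → 1 ≤ t →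
    (i j : ℕ) → 1 ≤ i → i ≤ k → 1 ≤ j → j ≤ k → i ≢ j →
    ((a la b lb : ℕ) → IntervalSubP k t i a la → IntervalSubP k t j b lb →
      2 * k * t ≤ la → 2 * k * t ≤ lb →
      ∃[ u ] ∃[ v ] (InInterval a la u × InInterval b lb v × Edge k t u v))
    ×
    ((a la b lb : ℕ) → IntervalSubP k t i a la → IntervalSubP k t j b lb →
      la ≤ 2 * k * t → lb ≤ 2 * k * t → Disjoint a la b lb →
      (es : List (ℕ × ℕ)) → Unique es →
      All (λ { (u , v) → InInterval a la u × InInterval b lb v × Edge k t u v }) es →
      length es ≤ (2 * k + 1) ^ 2)
lemma4 (suc (suc (suc κ))) (suc t′) (s≤s (s≤s (s≤s z≤n))) (s≤s z≤n) (suc i) (suc j) _ 1+i≤k _ 1+j≤k 1+i≢1+j =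
  (λ _ _ _ _ I⊆Pi J⊆Pj 2kt≤la 2kt≤lb →
    edge-between-long-intervals i≢j (≤-pred 1+i≤k) (≤-pred 1+j≤k) I⊆Pi J⊆Pj
      (≤-trans kt≤2kt 2kt≤la) (≤-trans kt≤2kt 2kt≤lb)) ,
  (λ _ _ _ _ I⊆Pi J⊆Pj la≤2kt lb≤2kt _ _ unique edges →
    ≤-trans (edges-between-short-intervals {i} {j} I⊆Pi J⊆Pj la≤2kt lb≤2kt unique edges) (m*m≤[m+1]^2 (2 * k)))
  where
  open Construction κ (suc t′)
  i≢j : i ≢ j
  i≢j = 1+i≢1+j ∘ cong suc
  kt≤2kt : k * suc t′ ≤ 2 * k * suc t′
  kt≤2kt = *-monoˡ-≤ (suc t′) (m≤m+n k (k + 0))
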